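{- Let $n,m\geq 1$. Then $\chi'_{CF}(K_{n,m})\leq 2$ if $\min\{n,m\}\leq 2$, and $\chi'_{CF}(K_{n,m})=3$ if $\min\{n,m\}\geq 3$. Moreover, $\chi'_{CF}(C_k)=2$ for every $k\geq 3$, where $C_k$ is the cycle of length $k$.
   Context: For a graph $G$ and an edge $uv$, the closed neighbourhood $E_G[uv]$ is the set of edges incident to $u$ or to $v$ (including $uv$). An edge colouring (not necessarily proper) of $G$ is conflict-free if for every edge $e$ some colour occurs on exactly one edge of $E_G[e]$; $\chi'_{CF}(G)$ is the least number of colours admitting such a colouring. -}

module Defs where

open import Data.Nat using (ℕ; zero; suc; _<_)
open import Data.Nat.DivMod using (_mod_)
open import Data.Fin using (Fin; toℕ)
open import Data.Empty using (⊥)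
open import Data.Sum using (_⊎_; inj₁; inj₂)
open import Data.Product using (Σ; _×_; _,_; proj₁; proj₂; ∃)
open import Relation.Binary.PropositionalEquality using (_≡_)
open import Relation.Nullary using (¬_)

record Graph : Set₁ where
  field
    V    : Set
    E    : Set
    ends : E → V × V

open Graph public

_∈ends_ : {G : Graph} → V G → E G → Set
_∈ends_ {G} w e = (w ≡ proj₁ (ends G e)) ⊎ (w ≡ proj₂ (ends G e))

-- f ∈ E_G[e] : f is incident to u or to v, where e = uv (includes e itself)
InClosedNbhd : (G : Graph) → E G → E G → Set
InClosedNbhd G e f = (_∈ends_ {G} (proj₁ (ends G e)) f) ⊎ (_∈ends_ {G} (proj₂ (ends G e)) f)

UniqueColourAt : (G : Graph) {k : ℕ} → (E G → Fin k) → E G → Fin k → Set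
UniqueColourAt G col e c =
  Σ (E G) λ f → InClosedNbhd G e f × col f ≡ c ×
    ((g : E G) → InClosedNbhd G e g → col g ≡ c → g ≡ f)

-- a (not necessarily proper) edge colouring with k colours that is conflict-free
IsConflictFree : (G : Graph) {k : ℕ} → (E G → Fin k) → Set
IsConflictFree G {k} col = (e : E G) → Σ (Fin k) λ c → UniqueColourAt G col e c

HasCFColouring : Graph → ℕ → Set
HasCFColouring G k = Σ (E G → Fin k) λ col → IsConflictFree G col

ChiCF≡ : Graph → ℕ → Set
ChiCF≡ G k = HasCFColouring G k × ((j : ℕ) → j < k → ¬ HasCFColouring G j)

K : ℕ → ℕ → Graph
K n m = record { V = Fin n ⊎ Fin m ; E = Fin n × Fin m
               ; ends = λ p → inj₁ (proj₁ p) , inj₂ (proj₂ p) }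

C : ℕ → Graph
C zero = record { V = ⊥ ; E = ⊥ ; ends = λ () }
C (suc k) = record { V = Fin (suc k) ; E = Fin (suc k)
                   ; ends = λ i → i , (suc (toℕ i) mod (suc k)) }

{-# OPTIONS --safe #-}
-- With two colours, a closed neighbourhood containing two edges of one colour contains at
-- most one edge of the other colour, and a closed neighbourhood with two edges is never
-- monochromatic.  In K_{n,m} with n, m ≥ 3 the edge carrying the unique colour at some edge
-- is then the only edge of its colour c in its row (or column).  The first rule makes
-- every edge outside its column avoid c, the second then forces another edge of its column
-- to have colour c, and the closed neighbourhood of that edge contains two edges of each
-- colour.  Three colours always suffice for K_{n,m}: single out one edge, give the rest of
-- its row a second colour and everything else a third.  A cycle is coloured by the parity
-- of the edge index; the closed neighbourhood of an edge consists of its predecessor,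
-- itself and its successor, which never all have the same parity.
module Submission where

open import Defs
open import Data.Nat using (ℕ; suc; z≤n; s≤s; _≤_; _<_; _⊓_; _%_)
open import Data.Product using (Σ; _×_; _,_; proj₁; proj₂; ∃; ∃₂; swap)
open import Data.Bool using (if_then_else_)
open import Data.Empty using (⊥; ⊥-elim)
open import Data.Fin using (Fin; zero; suc; toℕ; fromℕ; inject₁; _≟_)
open import Data.Fin.Properties using (toℕ-injective; toℕ-fromℕ<; toℕ-fromℕ; toℕ-inject₁; toℕ<n; suc-injective)
open import Data.Fin.Relation.Unary.Top using (view; ‵fromℕ; ‵inject₁)
open import Data.List using ([]; _∷_)
open import Data.List.Membership.Propositional using (_∈_)
open import Data.List.Relation.Unary.Any using (here; there)
open import Data.Nat.DivMod using (m<n⇒m%n≡m; n%n≡0)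
open import Data.Nat.Properties using (⊓-sel; m≤n⊓o⇒m≤n; m≤n⊓o⇒m≤o; ≤-refl; ≤-trans; n≤1+n)
import Data.Product.Properties as Product
open import Data.Sum using (_⊎_; inj₁; inj₂)
open import Data.Sum.Properties using (inj₁-injective; inj₂-injective)
open import Relation.Binary.Definitions using (DecidableEquality)
open import Relation.Binary.PropositionalEquality
open import Relation.Nullary using (¬_; yes; no; does)
open import Relation.Nullary.Decidable using (decidable-stable)

private
  variable
    n m k : ℕ

other : Fin 2 → Fin 2
other zero    = suc zero
other (suc _) = zero

other-≢ : (c : Fin 2) → other c ≢ c
other-≢ zero       ()
other-≢ (suc zero) ()

≢-≢⇒≡ : {a b c : Fin 2} → a ≢ c → b ≢ c → a ≡ b
≢-≢⇒≡ {zero}     {zero}                 _   _   = refl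
≢-≢⇒≡ {suc zero} {suc zero}             _   _   = refl
≢-≢⇒≡ {zero}     {suc zero} {zero}     a≢c _   = ⊥-elim (a≢c refl)
≢-≢⇒≡ {zero}     {suc zero} {suc zero} _   b≢c = ⊥-elim (b≢c refl)
≢-≢⇒≡ {suc zero} {zero}     {zero}     _   b≢c = ⊥-elim (b≢c refl)
≢-≢⇒≡ {suc zero} {zero}     {suc zero} a≢c _   = ⊥-elim (a≢c refl)

otherThan : 2 ≤ n → (a : Fin n) → ∃ λ b → b ≢ a
otherThan (s≤s (s≤s _)) zero    = suc zero , λ ()
otherThan (s≤s (s≤s _)) (suc _) = zero , λ ()

twoOthersThan : 3 ≤ n → (a : Fin n) → ∃₂ λ b c → b ≢ a × c ≢ a × b ≢ c
twoOthersThan (s≤s (s≤s (s≤s _))) zero          = suc zero , suc (suc zero) , (λ ()) , (λ ()) , (λ ())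
twoOthersThan (s≤s (s≤s (s≤s _))) (suc zero)    = zero , suc (suc zero) , (λ ()) , (λ ()) , (λ ())
twoOthersThan (s≤s (s≤s (s≤s _))) (suc (suc _)) = zero , suc zero , (λ ()) , (λ ()) , (λ ())

oddOneOut : {A : Set} (col : A → Fin 2) (x y z : A) → col x ≢ col y ⊎ col y ≢ col z →
  Σ A λ f → f ∈ x ∷ y ∷ z ∷ [] × ((g : A) → g ∈ x ∷ y ∷ z ∷ [] → col g ≡ col f → g ≡ f)
oddOneOut {A} col x y z nonConstant with col x ≟ col y | nonConstant
... | yes x~y | inj₁ x≁y = ⊥-elim (x≁y x~y)
... | yes x~y | inj₂ y≁z = z , there (there (here refl)) , unique
  where
  unique : (g : A) → g ∈ x ∷ y ∷ z ∷ [] → col g ≡ col z → g ≡ z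
  unique g (here refl)                 p = ⊥-elim (y≁z (trans (sym x~y) p))
  unique g (there (here refl))         p = ⊥-elim (y≁z p)
  unique g (there (there (here refl))) p = refl
... | no x≁y | _ with col z ≟ col x
...   | yes z~x = y , there (here refl) , unique
  where
  unique : (g : A) → g ∈ x ∷ y ∷ z ∷ [] → col g ≡ col y → g ≡ y
  unique g (here refl)                 p = ⊥-elim (x≁y p)
  unique g (there (here refl))         p = refl
  unique g (there (there (here refl))) p = ⊥-elim (x≁y (trans (sym z~x) p))
...   | no z≁x = x , here refl , unique
  where
  unique : (g : A) → g ∈ x ∷ y ∷ z ∷ [] → col g ≡ col x → g ≡ x
  unique g (here refl)                 p = refl
  unique g (there (here refl))         p = ⊥-elim (x≁y (sym p))
  unique g (there (there (here refl))) p = ⊥-elim (z≁x p)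

isolate : {A : Set} → DecidableEquality A → A → A → Fin 2
isolate _≟ᴬ_ f g = if does (g ≟ᴬ f) then suc zero else zero

module _ (G : Graph) where

  closedNbhd-refl : (e : E G) → InClosedNbhd G e e
  closedNbhd-refl e = inj₁ (inj₁ refl)

  noCFColouring-0 : E G → ¬ HasCFColouring G 0
  noCFColouring-0 e (col , _) with col e
  ... | ()

  noCFColouring-1 : (e f : E G) → InClosedNbhd G e f → e ≢ f → ¬ HasCFColouring G 1
  noCFColouring-1 e f f∈ e≢f (col , cf) with cf e
  ... | zero , _ , _ , _ , unique = e≢f (trans (unique e (closedNbhd-refl e) (colour col e))
                                              (sym (unique f f∈ (colour col f))))
    where
    colour : (col : E G → Fin 1) (g : E G) → col g ≡ zero
    colour col g with col g
    ... | zero = refl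

  noCFColouring-<2 : (e f : E G) → InClosedNbhd G e f → e ≢ f → (j : ℕ) → j < 2 → ¬ HasCFColouring G j
  noCFColouring-<2 e f f∈ e≢f 0 _ = noCFColouring-0 e
  noCFColouring-<2 e f f∈ e≢f 1 _ = noCFColouring-1 e f f∈ e≢f
  noCFColouring-<2 e f f∈ e≢f (suc (suc _)) (s≤s (s≤s ()))

  dominatingEdge⇒CF : (_≟ᴱ_ : DecidableEquality (E G)) (f : E G) →
    ((e : E G) → InClosedNbhd G e f) → IsConflictFree G (isolate _≟ᴱ_ f)
  dominatingEdge⇒CF _≟ᴱ_ f dominating e = suc zero , f , dominating e , isolated , unique
    where
    isolated : isolate _≟ᴱ_ f f ≡ suc zero
    isolated with f ≟ᴱ f
    ... | yes _  = refl
    ... | no f≢f = ⊥-elim (f≢f refl)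
    unique : (g : E G) → InClosedNbhd G e g → isolate _≟ᴱ_ f g ≡ suc zero → g ≡ f
    unique g _ g↦1 with g ≟ᴱ f
    unique g _ _   | yes g≡f = g≡f
    unique g _ ()  | no _

  module TwoColouring (col : E G → Fin 2) (cf : IsConflictFree G col) where

    majority⇒minority-unique : (e a b : E G) → InClosedNbhd G e a → InClosedNbhd G e b → a ≢ b →
      (c : Fin 2) → col a ≢ c → col b ≢ c →
      (x y : E G) → InClosedNbhd G e x → InClosedNbhd G e y → col x ≡ c → col y ≡ c → x ≡ y
    majority⇒minority-unique e a b a∈ b∈ a≢b c a≢c b≢c x y x∈ y∈ x≡c y≡c with cf e
    ... | c′ , f , _ , _ , unique with c′ ≟ c
    ...   | yes refl = trans (unique x x∈ x≡c) (sym (unique y y∈ y≡c))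
    ...   | no c′≢c  = ⊥-elim (a≢b (trans (unique a a∈ (≢-≢⇒≡ a≢c c′≢c))
                                           (sym (unique b b∈ (≢-≢⇒≡ b≢c c′≢c)))))

    avoids⇒closedNbhd-subsingleton : (e : E G) (c : Fin 2) →
      ((g : E G) → InClosedNbhd G e g → col g ≢ c) →
      (a b : E G) → InClosedNbhd G e a → InClosedNbhd G e b → a ≡ b
    avoids⇒closedNbhd-subsingleton e c avoids a b a∈ b∈ with cf e
    ... | c′ , f , f∈ , f↦c′ , unique with c′ ≟ c
    ...   | yes refl = ⊥-elim (avoids f f∈ f↦c′)
    ...   | no c′≢c  = trans (unique a a∈ (≢-≢⇒≡ (avoids a a∈) c′≢c))
                             (sym (unique b b∈ (≢-≢⇒≡ (avoids b b∈) c′≢c)))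

K-sameRow : (i : Fin n) (j j′ : Fin m) → InClosedNbhd (K n m) (i , j) (i , j′)
K-sameRow i j j′ = inj₁ (inj₁ refl)

K-sameColumn : (i i′ : Fin n) (j : Fin m) → InClosedNbhd (K n m) (i , j) (i′ , j)
K-sameColumn i i′ j = inj₂ (inj₂ refl)

K-closedNbhd⇒sharesEnd : {e f : Fin n × Fin m} → InClosedNbhd (K n m) e f →
  proj₁ e ≡ proj₁ f ⊎ proj₂ e ≡ proj₂ f
K-closedNbhd⇒sharesEnd (inj₁ (inj₁ p)) = inj₁ (inj₁-injective p)
K-closedNbhd⇒sharesEnd (inj₂ (inj₂ p)) = inj₂ (inj₂-injective p)

sharesEnd⇒K-closedNbhd : {e f : Fin n × Fin m} → proj₁ e ≡ proj₁ f ⊎ proj₂ e ≡ proj₂ f →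
  InClosedNbhd (K n m) e f
sharesEnd⇒K-closedNbhd (inj₁ p) = inj₁ (inj₁ (cong inj₁ p))
sharesEnd⇒K-closedNbhd (inj₂ p) = inj₂ (inj₂ (cong inj₂ p))

K-closedNbhd-swap : {e f : Fin n × Fin m} → InClosedNbhd (K n m) e f →
  InClosedNbhd (K m n) (swap e) (swap f)
K-closedNbhd-swap f∈ with K-closedNbhd⇒sharesEnd f∈
... | inj₁ p = sharesEnd⇒K-closedNbhd (inj₂ p)
... | inj₂ p = sharesEnd⇒K-closedNbhd (inj₁ p)

K-swap-CF : {k : ℕ} {col : Fin n × Fin m → Fin k} →
  IsConflictFree (K n m) col → IsConflictFree (K m n) (λ e → col (swap e))
K-swap-CF cf e with cf (swap e)
... | c , f , f∈ , f↦c , unique =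
  c , swap f , K-closedNbhd-swap f∈ , f↦c ,
  λ g g∈ g↦c → cong swap (unique (swap g) (K-closedNbhd-swap g∈) g↦c)

K-swap-HasCF : {k : ℕ} → HasCFColouring (K n m) k → HasCFColouring (K m n) k
K-swap-HasCF (col , cf) = (λ e → col (swap e)) , K-swap-CF cf

K-swap-ChiCF : {k : ℕ} → ChiCF≡ (K n m) k → ChiCF≡ (K m n) k
K-swap-ChiCF (colouring , minimal) = K-swap-HasCF colouring , λ j j<k h → minimal j j<k (K-swap-HasCF h)

K-noCFColouring-<2 : 1 ≤ n → 2 ≤ m → (j : ℕ) → j < 2 → ¬ HasCFColouring (K n m) j
K-noCFColouring-<2 {suc _} {1} _ (s≤s ())
K-noCFColouring-<2 {suc _} {suc (suc _)} _ _ =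
  noCFColouring-<2 (K _ _) (zero , zero) (zero , suc zero) (K-sameRow zero zero (suc zero)) λ ()

K1-CF : IsConflictFree (K 1 (suc m)) (isolate (Product.≡-dec _≟_ _≟_) (zero , zero))
K1-CF {m} = dominatingEdge⇒CF (K 1 (suc m)) (Product.≡-dec _≟_ _≟_) (zero , zero) λ { (zero , j) → K-sameRow zero j zero }

K2-rowCF : IsConflictFree (K 2 m) proj₁
K2-rowCF {m} (i , j) = other i , (other i , j) , K-sameColumn i (other i) j , refl , unique
  where
  unique : (g : Fin 2 × Fin m) → InClosedNbhd (K 2 m) (i , j) g → proj₁ g ≡ other i → g ≡ (other i , j)
  unique (x , y) g∈ x≡ with K-closedNbhd⇒sharesEnd g∈
  ... | inj₁ i≡x = ⊥-elim (other-≢ i (trans (sym x≡) (sym i≡x)))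
  ... | inj₂ j≡y = cong₂ _,_ x≡ (sym j≡y)

corner : {n m : ℕ} → Fin (suc n) × Fin (suc m) → Fin 3
corner (zero  , zero)  = suc (suc zero)
corner (zero  , suc _) = suc zero
corner (suc _ , _)     = zero

corner-CF : IsConflictFree (K (suc n) (suc m)) corner
corner-CF {n} {m} (zero , j) = corner {n} {m} (zero , zero) , (zero , zero) , K-sameRow zero j zero , refl , unique
  where
  unique : (g : Fin (suc n) × Fin (suc m)) → InClosedNbhd (K (suc n) (suc m)) (zero , j) g →
    corner g ≡ suc (suc zero) → g ≡ (zero , zero)
  unique (zero , zero) _ _ = refl
  unique (zero , suc _) _ ()
  unique (suc _ , _) _ ()
corner-CF {n} {m} (suc i , j) = corner (zero , j) , (zero , j) , K-sameColumn (suc i) zero j , refl , unique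
  where
  firstRow≢0 : (y : Fin (suc m)) → corner {n} (zero , y) ≢ zero
  firstRow≢0 zero ()
  firstRow≢0 (suc _) ()
  unique : (g : Fin (suc n) × Fin (suc m)) → InClosedNbhd (K (suc n) (suc m)) (suc i , j) g →
    corner g ≡ corner (zero , j) → g ≡ (zero , j)
  unique (suc x , y) _ g↦ = ⊥-elim (firstRow≢0 j (sym g↦))
  unique (zero , y) g∈ _ with K-closedNbhd⇒sharesEnd g∈
  ... | inj₂ j≡y = cong (zero ,_) (sym j≡y)

module _ {n m : ℕ} {col : Fin n × Fin m → Fin 2} (cf : IsConflictFree (K n m) col) where
  open TwoColouring (K n m) col cf

  OnlyOfItsColourInRow : Fin n → Fin m → Set
  OnlyOfItsColourInRow i j = (j′ : Fin m) → col (i , j′) ≡ col (i , j) → j′ ≡ j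

  onlyOfItsColourInRow⇒⊥ : {i i′ : Fin n} {j j₁ j₂ : Fin m} → i′ ≢ i → j₁ ≢ j → j₂ ≢ j → j₁ ≢ j₂ →
    ¬ OnlyOfItsColourInRow i j
  onlyOfItsColourInRow⇒⊥ {i} {i′} {j} {j₁} {j₂} i′≢i j₁≢j j₂≢j j₁≢j₂ only =
    i′≢i (cong proj₁ (sym sameColumnAsLonely))
    where
    c = col (i , j)
    offColumn : {j′ : Fin m} → j′ ≢ j → (x : Fin n) → col (x , j′) ≢ c
    offColumn {j′} j′≢j x x↦c = j′≢j (cong proj₂
      (majority⇒minority-unique (i , j′) (i , j₁) (i , j₂)
        (K-sameRow i j′ j₁) (K-sameRow i j′ j₂) (λ p → j₁≢j₂ (cong proj₂ p))
        c (λ p → j₁≢j (only j₁ p)) (λ p → j₂≢j (only j₂ p))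
        (x , j′) (i , j) (K-sameColumn i x j′) (sharesEnd⇒K-closedNbhd (inj₁ refl)) x↦c refl))
    i′↦c : col (i′ , j) ≡ c
    i′↦c = decidable-stable (col (i′ , j) ≟ c) λ i′↦̸c →
      j₁≢j₂ (cong proj₂ (avoids⇒closedNbhd-subsingleton (i′ , j₁) c (avoids i′↦̸c)
        (i′ , j₁) (i′ , j₂) (K-sameRow i′ j₁ j₁) (K-sameRow i′ j₁ j₂)))
      where
      avoids : col (i′ , j) ≢ c → (g : Fin n × Fin m) → InClosedNbhd (K n m) (i′ , j₁) g → col g ≢ c
      avoids i′↦̸c (x , y) g∈ with K-closedNbhd⇒sharesEnd g∈ | y ≟ j
      ... | inj₁ refl | yes refl = i′↦̸c
      ... | inj₁ _    | no y≢j   = offColumn y≢j x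
      ... | inj₂ refl | _        = offColumn j₁≢j x
    sameColumnAsLonely : (i , j) ≡ (i′ , j)
    sameColumnAsLonely =
      majority⇒minority-unique (i′ , j) (i′ , j₁) (i′ , j₂)
        (K-sameRow i′ j j₁) (K-sameRow i′ j j₂) (λ p → j₁≢j₂ (cong proj₂ p))
        c (offColumn j₁≢j i′) (offColumn j₂≢j i′)
        (i , j) (i′ , j) (K-sameColumn i′ i j) (closedNbhd-refl (K n m) (i′ , j)) refl i′↦c

  noOnlyOfItsColourInRow : 2 ≤ n → 3 ≤ m → (i : Fin n) (j : Fin m) → ¬ OnlyOfItsColourInRow i j
  noOnlyOfItsColourInRow 2≤n 3≤m i j with otherThan 2≤n i | twoOthersThan 3≤m j
  ... | i′ , i′≢i | j₁ , j₂ , j₁≢j , j₂≢j , j₁≢j₂ = onlyOfItsColourInRow⇒⊥ i′≢i j₁≢j j₂≢j j₁≢j₂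

K-no2Colouring : 3 ≤ n → 3 ≤ m → ¬ HasCFColouring (K n m) 2
K-no2Colouring {suc _} {suc _} 3≤n 3≤m (col , cf) with cf (zero , zero)
... | c , (i , j) , f∈ , f↦c , unique with K-closedNbhd⇒sharesEnd f∈
... | inj₁ 0≡i = noOnlyOfItsColourInRow cf (≤-trans (n≤1+n 2) 3≤n) 3≤m i j
      λ j′ p → cong proj₂ (unique (i , j′) (sharesEnd⇒K-closedNbhd (inj₁ 0≡i)) (trans p f↦c))
... | inj₂ 0≡j = noOnlyOfItsColourInRow (K-swap-CF cf) (≤-trans (n≤1+n 2) 3≤m) 3≤n j i
      λ i′ p → cong proj₁ (unique (i′ , j) (sharesEnd⇒K-closedNbhd (inj₂ 0≡j)) (trans p f↦c))

K-ChiCF-≤2 : 1 ≤ n → 1 ≤ m → n ≤ 2 → Σ ℕ λ j → j ≤ 2 × ChiCF≡ (K n m) j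
K-ChiCF-≤2 {1} {1} _ _ _ =
  1 , s≤s z≤n , ((λ _ → zero) , λ e → zero , e , closedNbhd-refl (K 1 1) e , refl , λ g _ _ → single g e) ,
  λ { 0 _ → noCFColouring-0 (K 1 1) (zero , zero) ; (suc _) (s≤s ()) }
  where
  single : (e f : Fin 1 × Fin 1) → e ≡ f
  single (zero , zero) (zero , zero) = refl
K-ChiCF-≤2 {1} {suc (suc m)} 1≤n 2≤m _ =
  2 , ≤-refl , (_ , K1-CF) , K-noCFColouring-<2 1≤n (s≤s (s≤s z≤n))
K-ChiCF-≤2 {2} 1≤n 1≤m _ =
  2 , ≤-refl , (proj₁ , K2-rowCF) , λ j j<2 h → K-noCFColouring-<2 1≤m (s≤s (s≤s z≤n)) j j<2 (K-swap-HasCF h)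
K-ChiCF-≤2 {suc (suc (suc _))} _ _ (s≤s (s≤s ()))

K-ChiCF-3 : 3 ≤ n → 3 ≤ m → ChiCF≡ (K n m) 3
K-ChiCF-3 {suc _} {suc _} 3≤n 3≤m = (corner , corner-CF) , minimal
  where
  minimal : (j : ℕ) → j < 3 → ¬ HasCFColouring (K _ _) j
  minimal 0 _ = K-noCFColouring-<2 (s≤s z≤n) (≤-trans (n≤1+n 2) 3≤m) 0 (s≤s z≤n)
  minimal 1 _ = K-noCFColouring-<2 (s≤s z≤n) (≤-trans (n≤1+n 2) 3≤m) 1 (s≤s (s≤s z≤n))
  minimal 2 _ = K-no2Colouring 3≤n 3≤m
  minimal (suc (suc (suc _))) (s≤s (s≤s (s≤s ())))

parity : ℕ → Fin 2
parity 0             = zero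
parity 1             = suc zero
parity (suc (suc n)) = parity n

parity-suc : (n : ℕ) → parity (suc n) ≢ parity n
parity-suc 0             ()
parity-suc 1             ()
parity-suc (suc (suc n)) = parity-suc n

next : Fin (suc k) → Fin (suc k)
next {k} i = proj₂ (ends (C (suc k)) i)

prev : Fin (suc k) → Fin (suc k)
prev {k} zero = fromℕ k
prev (suc i)  = inject₁ i

next-fromℕ : next (fromℕ k) ≡ zero
next-fromℕ {k} = toℕ-injective (begin
  toℕ (next (fromℕ k))        ≡⟨ toℕ-fromℕ< _ ⟩
  suc (toℕ (fromℕ k)) % suc k ≡⟨ cong (λ x → suc x % suc k) (toℕ-fromℕ k) ⟩
  suc k % suc k               ≡⟨ n%n≡0 (suc k) ⟩
  0                           ∎)
  where open ≡-Reasoning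

next-inject₁ : (i : Fin k) → next (inject₁ i) ≡ suc i
next-inject₁ {k} i = toℕ-injective (begin
  toℕ (next (inject₁ i))        ≡⟨ toℕ-fromℕ< _ ⟩
  suc (toℕ (inject₁ i)) % suc k ≡⟨ cong (λ x → suc x % suc k) (toℕ-inject₁ i) ⟩
  suc (toℕ i) % suc k           ≡⟨ m<n⇒m%n≡m (s≤s (toℕ<n i)) ⟩
  suc (toℕ i)                   ∎)
  where open ≡-Reasoning

next-prev : (e : Fin (suc k)) → next (prev e) ≡ e
next-prev zero    = next-fromℕ
next-prev (suc i) = next-inject₁ i

next-injective : (x y : Fin (suc k)) → next x ≡ next y → x ≡ y
next-injective x y eq with view x | view y
... | ‵fromℕ     | ‵fromℕ     = refl
... | ‵fromℕ     | ‵inject₁ j with () ← trans (sym next-fromℕ) (trans eq (next-inject₁ j))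
... | ‵inject₁ i | ‵fromℕ     with () ← trans (sym (next-inject₁ i)) (trans eq next-fromℕ)
... | ‵inject₁ i | ‵inject₁ j =
  cong inject₁ (suc-injective (trans (sym (next-inject₁ i)) (trans eq (next-inject₁ j))))

C-closedNbhd⇒ : (e g : Fin (suc k)) → InClosedNbhd (C (suc k)) e g → g ∈ prev e ∷ e ∷ next e ∷ []
C-closedNbhd⇒ e g (inj₁ (inj₁ e≡g))      = there (here (sym e≡g))
C-closedNbhd⇒ e g (inj₁ (inj₂ e≡next-g)) = here (next-injective g (prev e) (trans (sym e≡next-g) (sym (next-prev e))))
C-closedNbhd⇒ e g (inj₂ (inj₁ next-e≡g)) = there (there (here (sym next-e≡g)))
C-closedNbhd⇒ e g (inj₂ (inj₂ eq))       = there (here (next-injective g e (sym eq)))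

⇒C-closedNbhd : (e g : Fin (suc k)) → g ∈ prev e ∷ e ∷ next e ∷ [] → InClosedNbhd (C (suc k)) e g
⇒C-closedNbhd e g (here refl)                 = inj₁ (inj₂ (sym (next-prev e)))
⇒C-closedNbhd e g (there (here refl))         = inj₁ (inj₁ refl)
⇒C-closedNbhd e g (there (there (here refl))) = inj₂ (inj₁ refl)

alternate : Fin k → Fin 2
alternate i = parity (toℕ i)

alternate-not-constant : (e : Fin (suc (suc k))) →
  alternate (prev e) ≢ alternate e ⊎ alternate e ≢ alternate (next e)
alternate-not-constant {k} zero = inj₂ λ p → parity-suc 0 (sym (trans p (cong alternate (next-inject₁ {suc k} zero))))
alternate-not-constant     (suc i) = inj₁ λ p → parity-suc (toℕ i) (sym (trans (cong parity (sym (toℕ-inject₁ i))) p))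

C-alternate-CF : IsConflictFree (C (suc (suc k))) alternate
C-alternate-CF e with oddOneOut alternate (prev e) e (next e) (alternate-not-constant e)
... | f , f∈ , unique = alternate f , f , ⇒C-closedNbhd e f f∈ , refl , λ g g∈ → unique g (C-closedNbhd⇒ e g g∈)

C-ChiCF-2 : 2 ≤ k → ChiCF≡ (C k) 2
C-ChiCF-2 {1} (s≤s ())
C-ChiCF-2 {suc (suc k)} _ =
  (alternate , C-alternate-CF) ,
  noCFColouring-<2 (C (suc (suc k))) zero (next zero) (⇒C-closedNbhd zero (next zero) (there (there (here refl)))) zero≢next-zero
  where
  zero≢next-zero : zero ≢ next {suc k} zero
  zero≢next-zero p with () ← trans p (next-inject₁ zero)

mainTheorem7 : ((n m : ℕ) → 1 ≤ n → 1 ≤ m →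
    ((n ⊓ m ≤ 2 → Σ ℕ λ j → j ≤ 2 × ChiCF≡ (K n m) j)
    × (3 ≤ n ⊓ m → ChiCF≡ (K n m) 3)))
    × ((k : ℕ) → 3 ≤ k → ChiCF≡ (C k) 2)
mainTheorem7 = (λ n m 1≤n 1≤m → small n m 1≤n 1≤m , large n m) , λ k 3≤k → C-ChiCF-2 {k} (≤-trans (n≤1+n 2) 3≤k)
  where
  small : (n m : ℕ) → 1 ≤ n → 1 ≤ m → n ⊓ m ≤ 2 → Σ ℕ λ j → j ≤ 2 × ChiCF≡ (K n m) j
  small n m 1≤n 1≤m n⊓m≤2 with ⊓-sel n m
  ... | inj₁ n⊓m≡n = K-ChiCF-≤2 1≤n 1≤m (subst (_≤ 2) n⊓m≡n n⊓m≤2)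
  ... | inj₂ n⊓m≡m with K-ChiCF-≤2 1≤m 1≤n (subst (_≤ 2) n⊓m≡m n⊓m≤2)
  ...   | j , j≤2 , χ = j , j≤2 , K-swap-ChiCF χ
  large : (n m : ℕ) → 3 ≤ n ⊓ m → ChiCF≡ (K n m) 3
  large n m 3≤n⊓m = K-ChiCF-3 (m≤n⊓o⇒m≤n n m 3≤n⊓m) (m≤n⊓o⇒m≤o n m 3≤n⊓m)
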